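{- Let $\mathcal T$ be a tangle of order $k$ in a connectivity system $(E,\lambda)$, and let $\mathcal S$ be a tree compatible set. Let $\Phi=(P_1,P_2,\dots,P_n)$ be a $k$-flower in $\mathcal T$ of $\mathcal S$-order at least two with no $\mathcal T$-loose petals. If $X\subseteq E-P_1$ is a non-empty $\mathcal T$-weak set such that $P_1\cup X$ is $k$-separating, then $P_i-X$ is $\mathcal T$-strong for all $i\in\{2,\dots,n\}$.
   Context: A connectivity system is a pair $(E,\lambda)$ with $E$ finite and $\lambda$ an integer-valued symmetric ($\lambda(X)=\lambda(E-X)$) submodular function on subsets of $E$. $X$ is $k$-separating if $\lambda(X)\le k$; a $k$-separation is an unordered partition $(X,E-X)$ (parts may be empty) with $\lambda(X)\le k$. A tangle of order $k$ is a collection $\mathcal T$ of subsets of $E$ with (T1) $\lambda(A)<k$ for $A\in\mathcal T$; (T2) if $\lambda(A)\le k-1$ then $A\in\mathcal T$ or $E-A\in\mathcal T$; (T3) no three members have union $E$; (T4) $E-\{e\}\notin\mathcal T$. $X$ is $\mathcal T$-weak if contained in a member of $\mathcal T$, else $\mathcal T$-strong; a partition is $\mathcal T$-strong if all parts are. A $\mathcal T$-strong $k$-separating $X$ is fully closed if no non-empty $\mathcal T$-weak $Y\subseteq E-X$ has $X\cup Y$ $k$-separating; $\mathrm{fcl}_{\mathcal T}(X)$ is the intersection of all fully closed $k$-separating sets containing $X$. $\mathcal T$-strong $k$-separations $(X,Y),(X',Y')$ are $\mathcal T$-equivalent if $\{\mathrm{fcl}_{\mathcal T}(X),\mathrm{fcl}_{\mathcal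 T}(Y)\}=\{\mathrm{fcl}_{\mathcal T}(X'),\mathrm{fcl}_{\mathcal T}(Y')\}$. A $k$-separating $X$ is $\mathcal T$-sequential if $E-X$ is $\mathcal T$-strong and $\mathrm{fcl}_{\mathcal T}(E-X)=E$. Let $\mathcal S$ be a set of $k$-separating sets that are not $\mathcal T$-sequential and have $\mathcal T$-strong complements; a $(k,\mathcal S)$-separation is a $k$-separation with both sides in $\mathcal S$. $\mathcal S$ is tree compatible if (S1) any $\mathcal T$-strong $k$-separation $\mathcal T$-equivalent to a $(k,\mathcal S)$-separation is a $(k,\mathcal S)$-separation; (S2) if $X\in\mathcal S$ and $(Y,E-Y)$ is a $\mathcal T$-strong $k$-separation with $X\subseteq Y$, then $Y\in\mathcal S$. A $k$-flower in $\mathcal T$ is a $\mathcal T$-strong partition $(P_1,\dots,P_n)$ of $E$ with each $P_i$ and $P_i\cup P_{i+1}$ (indices mod $n$) $k$-separating; it displays $(X,E-X)$ if $X$ is a union of petals. With $P_I=\bigcup_{i\in I}P_i$, a $k$-anemone is a $k$-flower with $P_I$ $k$-separating for all non-empty $I$. $\Phi_1\preccurlyeq_{\mathcal S}\Phi_2$ if each $(k,\mathcal S)$-separation displayed by $\Phi_1$ is $\mathcal T$-equivalent to a $(k,\mathcal S)$-separation displayed by $\Phi_2$; flowers are equivalent if both relations hold. The $\mathcal S$-order of $\Phi$ is the minimum number of petals of a $k$-flower equivalent to $\Phi$. A petal $P_i$ is $\mathcal T$-loose if $P_i\subseteq\mathrm{fcl}_{\mathcal T}(P_j)$ for some petal $P_j\ne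 P_i$ that is cyclically adjacent to $P_i$ (or any other petal if $\Phi$ is a $k$-anemone). -}

module Defs where

open import Data.Nat as ℕ using (ℕ; zero; suc)
open import Data.Integer as ℤ using (ℤ; _+_; _-_; _≤_; _<_; 1ℤ)
open import Data.Fin using (Fin; zero; suc; toℕ)
open import Data.Fin.Subset
  using (Subset; _∪_; _∩_; ∁; _⊆_; _∈_; Nonempty; ⁅_⁆; ⊤; ⊥; _─_)
open import Data.Vec using (_∷_; [])
open import Data.Bool using (true; false)
open import Data.Product using (Σ; ∃; _×_; _,_)
open import Data.Sum using (_⊎_)
open import Relation.Nullary using (¬_)
open import Relation.Binary.PropositionalEquality using (_≡_; _≢_)

record ConnSystem (m : ℕ) : Set where
  field
    conn      : Subset m → ℤ
    symmetric : ∀ X → conn X ≡ conn (∁ X)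
    submod    : ∀ X Y → conn (X ∪ Y) + conn (X ∩ Y) ≤ conn X + conn Y
open ConnSystem public

unionOf : ∀ {m n} → (Fin n → Subset m) → Subset n → Subset m
unionOf {n = zero}  P []       = ⊥
unionOf {n = suc n} P (true  ∷ I) = P zero ∪ unionOf (λ i → P (suc i)) I
unionOf {n = suc n} P (false ∷ I) = unionOf (λ i → P (suc i)) I

-- j is the cyclic successor of i (indices mod n).
CycSucc : ∀ {n} → Fin n → Fin n → Set
CycSucc {n} i j = suc (toℕ i) ≡ toℕ j ⊎ (suc (toℕ i) ≡ n × toℕ j ≡ 0)

module _ {m : ℕ} (C : ConnSystem m) (k : ℤ) where

  KSep : Subset m → Set
  KSep X = conn C X ≤ k

  record IsTangle (T : Subset m → Set) : Set where
    field
      T1 : ∀ A → T A → conn C A < k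
      T2 : ∀ A → conn C A ≤ k - 1ℤ → T A ⊎ T (∁ A)
      T3 : ∀ A B D → T A → T B → T D → (A ∪ B) ∪ D ≢ ⊤
      T4 : ∀ e → ¬ T (∁ ⁅ e ⁆)

  module _ (T : Subset m → Set) where

    Weak : Subset m → Set
    Weak X = ∃ λ A → T A × X ⊆ A

    Strong : Subset m → Set
    Strong X = ¬ Weak X

    StrongSep : Subset m → Set
    StrongSep X = KSep X × Strong X × Strong (∁ X)

    FullyClosed : Subset m → Set
    FullyClosed X = Strong X × KSep X ×
      (∀ Y → Y ⊆ ∁ X → Nonempty Y → Weak Y → ¬ KSep (X ∪ Y))

    -- membership in fcl_T(X): intersection of all fully closed
    -- k-separating sets containing X
    InFcl : Subset m → Fin m → Set
    InFcl X e = ∀ Z → FullyClosed Z → X ⊆ Z → e ∈ Z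

    FclEq : Subset m → Subset m → Set
    FclEq X Y = ∀ e → (InFcl X e → InFcl Y e) × (InFcl Y e → InFcl X e)

    TEquiv : Subset m → Subset m → Set
    TEquiv X X' = (FclEq X X' × FclEq (∁ X) (∁ X'))
                ⊎ (FclEq X (∁ X') × FclEq (∁ X) X')

    Sequential : Subset m → Set
    Sequential X = KSep X × Strong (∁ X) × (∀ e → InFcl (∁ X) e)

    module _ (S : Subset m → Set) where

      ValidS : Set
      ValidS = ∀ X → S X → KSep X × ¬ Sequential X × Strong (∁ X)

      KSSep : Subset m → Set
      KSSep X = KSep X × S X × S (∁ X)

      record TreeCompatible : Set where
        field
          S1 : ∀ X X' → KSSep X → StrongSep X' → TEquiv X X' → KSSep X'
          S2 : ∀ X Y → S X → StrongSep Y → X ⊆ Y → S Y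

      record IsFlower {n : ℕ} (P : Fin n → Subset m) : Set where
        field
          strongPetals : ∀ i → Strong (P i)
          disjoint     : ∀ i j → i ≢ j → P i ∩ P j ≡ ⊥
          covers       : unionOf P ⊤ ≡ ⊤
          petalSep     : ∀ i → KSep (P i)
          adjSep       : ∀ i j → CycSucc i j → KSep (P i ∪ P j)

      record Flower : Set where
        field
          size    : ℕ
          petal   : Fin size → Subset m
          isFlower : IsFlower petal
      open Flower

      Displays : Flower → Subset m → Set
      Displays Φ X = ∃ λ I → X ≡ unionOf (petal Φ) I

      IsAnemone : Flower → Set
      IsAnemone Φ = ∀ I → Nonempty I → KSep (unionOf (petal Φ) I)

      _≼_ : Flower → Flower → Set
      Φ₁ ≼ Φ₂ = ∀ X → Displays Φ₁ X → KSSep X →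
        ∃ λ X' → Displays Φ₂ X' × KSSep X' × TEquiv X X'

      FlowerEquiv : Flower → Flower → Set
      FlowerEquiv Φ₁ Φ₂ = Φ₁ ≼ Φ₂ × Φ₂ ≼ Φ₁

      SOrderAtLeast2 : Flower → Set
      SOrderAtLeast2 Φ = ∀ Ψ → FlowerEquiv Ψ Φ → 2 ℕ.≤ size Ψ

      LoosePetal : (Φ : Flower) → Fin (size Φ) → Set
      LoosePetal Φ i = ∃ λ j → j ≢ i ×
        (CycSucc i j ⊎ CycSucc j i ⊎ IsAnemone Φ) ×
        (∀ e → e ∈ petal Φ i → InFcl (petal Φ j) e)

      NoLoosePetals : Flower → Set
      NoLoosePetals Φ = ∀ i → ¬ LoosePetal Φ i

      mkFlower : ∀ {n} (P : Fin n → Subset m) → IsFlower P → Flower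
      mkFlower {n} P isF = record { size = n ; petal = P ; isFlower = isF }

module Submission where

-- The argument only uses the flower axioms, the tangle axioms and the
-- absence of loose petals.  Its engine is an absorption principle for full
-- closures ('weak-absorbed'): if Q is strong, Y is weak and Q ∪ Y is
-- k-separating, then Y ⊆ fcl(Q).  Applying it twice ('split-absorbed')
-- shows that a petal B whose part B − X is weak lies in fcl(A) as soon as
-- A ∪ B is k-separating and B ∩ X ⊆ fcl(A); so B − X weak makes B loose.
--   * For the last petal Pₙ (a neighbour of P₀) this is immediate, since
--     X ⊆ fcl(P₀).
--   * For an inner petal P_{j+1} (j + 1 < n) let D = P₀ ∪ … ∪ Pⱼ ∪ X, which
--     is k-separating by uncrossing along the flower, and V = Pⱼ ∪ P_{j+1}.
--     D ∪ V separates P₀ from the strong set Pₙ − X, so λ(D ∪ V) ≥ k and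
--     hence D ∩ V = Pⱼ ∪ (P_{j+1} ∩ X) is k-separating; this puts P_{j+1} ∩ X
--     into fcl(Pⱼ), and P_{j+1} would be loose.

open import Defs
open import Data.Nat using (ℕ) renaming (suc to sucℕ)
open import Data.Integer using (ℤ)
open import Data.Fin using (Fin; zero; suc)
open import Data.Fin.Subset using (Subset; _∪_; _∩_; ∁; _⊆_; Nonempty)

import Data.Nat as ℕ
import Data.Nat.Properties as ℕP
open import Data.Integer using (_+_; _-_; 1ℤ; -1ℤ; _≤_; _<_)
import Data.Integer.Properties as ℤP
open import Data.Fin using (toℕ; fromℕ; fromℕ<; inject₁)
import Data.Fin.Properties as FinP
open import Data.Fin.Subset using (_∈_; _∉_; ⊤; ⊥)
open import Data.Fin.Subset.Properties
open import Data.Vec using (_∷_; []; tabulate)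
open import Data.Vec.Base using (here; there)
open import Data.Vec.Properties using ([]=⇒lookup; lookup⇒[]=; lookup∘tabulate)
open import Data.Bool using (true; false)
open import Data.Bool.Properties using (T-≡)
open import Data.Product using (∃; _×_; _,_; proj₁; proj₂)
open import Data.Sum using (_⊎_; inj₁; inj₂; [_,_]; [_,_]′)
import Data.Sum as Sum
open import Data.Empty using (⊥-elim)
open import Relation.Nullary using (¬_; yes; no)
open import Relation.Binary.PropositionalEquality hiding ([_])
open import Function.Bundles using (Equivalence)

-- An integer strictly below k is at most k − 1 (the form used by axiom T2).
<⇒≤-1 : ∀ {a k} → a < k → a ≤ k - 1ℤ
<⇒≤-1 {a} {k} a<k = subst (a ≤_) (ℤP.+-comm -1ℤ k) (ℤP.i<j⇒i≤pred[j] a<k)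

uncross-≤ : ∀ {k a b c d} → a + b ≤ c + d → c ≤ k → d ≤ k → k ≤ b → a ≤ k
uncross-≤ {k} {a} sum≤ c≤k d≤k k≤b with a ℤP.≤? k
... | yes a≤k = a≤k
... | no  a≰k = ⊥-elim (ℤP.<-irrefl refl (ℤP.<-≤-trans
        (ℤP.+-mono-<-≤ (ℤP.≰⇒> a≰k) k≤b) (ℤP.≤-trans sum≤ (ℤP.+-mono-≤ c≤k d≤k))))

halve-≤ : ∀ {a b} → a + a ≤ b + b → a ≤ b
halve-≤ {a} {b} h with a ℤP.≤? b
... | yes a≤b = a≤b
... | no  a≰b = ⊥-elim (ℤP.<-irrefl refl
        (ℤP.<-≤-trans (ℤP.+-mono-< (ℤP.≰⇒> a≰b) (ℤP.≰⇒> a≰b)) h))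

∪-least : ∀ {m} {A B D : Subset m} → A ⊆ D → B ⊆ D → A ∪ B ⊆ D
∪-least {A = A} {B} A⊆D B⊆D x∈ = [ A⊆D , B⊆D ] (x∈p∪q⁻ A B x∈)

∩-greatest : ∀ {m} {A B D : Subset m} → D ⊆ A → D ⊆ B → D ⊆ A ∩ B
∩-greatest D⊆A D⊆B x∈ = x∈p∩q⁺ (D⊆A x∈ , D⊆B x∈)

∩-split : ∀ {m} (B X : Subset m) → B ⊆ (B ∩ X) ∪ (B ∩ ∁ X)
∩-split B X {x} x∈B with x ∈? X
... | yes x∈X = p⊆p∪q _ (x∈p∩q⁺ (x∈B , x∈X))
... | no  x∉X = q⊆p∪q _ _ (x∈p∩q⁺ (x∈B , x∉p⇒x∈∁p x∉X))

∪⊆∪-outside : ∀ {m} (Z Y : Subset m) → Z ∪ Y ⊆ Z ∪ (Y ∩ ∁ Z)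
∪⊆∪-outside Z Y = ∪-least (p⊆p∪q _)
  (⊆-trans (∩-split Y Z) (∪-least (⊆-trans (p∩q⊆q Y Z) (p⊆p∪q _)) (q⊆p∪q Z _)))

∁⊥≡⊤ : ∀ {m} → ∁ {m} ⊥ ≡ ⊤
∁⊥≡⊤ = ⊆-antisym ⊆⊤ (λ _ → x∉p⇒x∈∁p ∉⊥)

unionOf⁻ : ∀ {m n} (P : Fin n → Subset m) (I : Subset n) {x} →
  x ∈ unionOf P I → ∃ λ s → s ∈ I × x ∈ P s
unionOf⁻ {n = ℕ.zero} P [] x∈ = ⊥-elim (∉⊥ x∈)
unionOf⁻ {n = sucℕ n} P (true ∷ I) x∈ with x∈p∪q⁻ (P zero) (unionOf (λ i → P (suc i)) I) x∈
... | inj₁ x∈P₀ = zero , here , x∈P₀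
... | inj₂ x∈rest with unionOf⁻ (λ i → P (suc i)) I x∈rest
...   | s , s∈I , x∈Pₛ = suc s , there s∈I , x∈Pₛ
unionOf⁻ {n = sucℕ n} P (false ∷ I) x∈ with unionOf⁻ (λ i → P (suc i)) I x∈
... | s , s∈I , x∈Pₛ = suc s , there s∈I , x∈Pₛ

unionOf⁺ : ∀ {m n} (P : Fin n → Subset m) (I : Subset n) {s} →
  s ∈ I → P s ⊆ unionOf P I
unionOf⁺ {n = sucℕ n} P (true ∷ I) here x∈ = p⊆p∪q _ x∈
unionOf⁺ {n = sucℕ n} P (true ∷ I) (there s∈I) x∈ =
  q⊆p∪q (P zero) _ (unionOf⁺ (λ i → P (suc i)) I s∈I x∈)
unionOf⁺ {n = sucℕ n} P (false ∷ I) (there s∈I) x∈ = unionOf⁺ (λ i → P (suc i)) I s∈I x∈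

module Segments {m n : ℕ} (P : Fin n → Subset m) where

  initial : ℕ → Subset n
  initial h = tabulate (λ s → toℕ s ℕ.≤ᵇ h)

  ∈initial⁺ : ∀ {h s} → toℕ s ℕ.≤ h → s ∈ initial h
  ∈initial⁺ {h} {s} s≤h = lookup⇒[]= s (initial h)
    (trans (lookup∘tabulate _ s) (Equivalence.to T-≡ (ℕP.≤⇒≤ᵇ s≤h)))

  ∈initial⁻ : ∀ {h s} → s ∈ initial h → toℕ s ℕ.≤ h
  ∈initial⁻ {h} {s} s∈ = ℕP.≤ᵇ⇒≤ (toℕ s) h
    (Equivalence.from T-≡ (trans (sym (lookup∘tabulate _ s)) ([]=⇒lookup s∈)))

  segment : ℕ → Subset m
  segment h = unionOf P (initial h)

  segment⁺ : ∀ {h s} → toℕ s ℕ.≤ h → P s ⊆ segment h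
  segment⁺ s≤h = unionOf⁺ P _ (∈initial⁺ s≤h)

  segment⁻ : ∀ {h x} → x ∈ segment h → ∃ λ s → toℕ s ℕ.≤ h × x ∈ P s
  segment⁻ {h} x∈ with unionOf⁻ P (initial h) x∈
  ... | s , s∈ , x∈Pₛ = s , ∈initial⁻ s∈ , x∈Pₛ

  segment-mono : ∀ {h h'} → h ℕ.≤ h' → segment h ⊆ segment h'
  segment-mono h≤h' x∈ with segment⁻ x∈
  ... | s , s≤h , x∈Pₛ = segment⁺ (ℕP.≤-trans s≤h h≤h') x∈Pₛ

  segment-suc : ∀ {h b} → toℕ b ≡ sucℕ h → segment (sucℕ h) ⊆ segment h ∪ P b
  segment-suc {h} {b} tb x∈ with segment⁻ x∈
  ... | s , s≤h+1 , x∈Pₛ with ℕP.m≤n⇒m<n∨m≡n s≤h+1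
  ...   | inj₁ s<h+1 = p⊆p∪q _ (segment⁺ (ℕP.≤-pred s<h+1) x∈Pₛ)
  ...   | inj₂ s≡h+1 =
          q⊆p∪q _ _ (subst (λ t → _ ∈ P t) (FinP.toℕ-injective (trans s≡h+1 (sym tb))) x∈Pₛ)

conn-⊥≡conn-⊤ : ∀ {m} (C : ConnSystem m) → conn C ⊥ ≡ conn C ⊤
conn-⊥≡conn-⊤ C = trans (symmetric C ⊥) (cong (conn C) ∁⊥≡⊤)

-- In any connectivity system the ground set has minimum connectivity:
-- submodularity on A, E − A gives 2λ(E) ≤ 2λ(A).
conn-⊤-least : ∀ {m} (C : ConnSystem m) (A : Subset m) → conn C ⊤ ≤ conn C A
conn-⊤-least C A = halve-≤ (begin
  conn C ⊤ + conn C ⊤                 ≡⟨ cong (conn C ⊤ +_) (sym (conn-⊥≡conn-⊤ C)) ⟩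
  conn C ⊤ + conn C ⊥                 ≡⟨ cong₂ _+_ (cong (conn C) (sym (p∪∁p≡⊤ A)))
                                                   (cong (conn C) (sym (∩-inverseʳ A))) ⟩
  conn C (A ∪ ∁ A) + conn C (A ∩ ∁ A) ≤⟨ submod C A (∁ A) ⟩
  conn C A + conn C (∁ A)             ≡⟨ cong (conn C A +_) (sym (symmetric C A)) ⟩
  conn C A + conn C A                 ∎)
  where open ℤP.≤-Reasoning

module TangleFacts {m : ℕ} (C : ConnSystem m) (k : ℤ) (T : Subset m → Set)
                   (tangle : IsTangle C k T) where
  open IsTangle tangle

  Sep IsWeak IsStrong Closed : Subset m → Set
  Sep      = KSep C k
  IsWeak   = Weak C k T
  IsStrong = Strong C k T
  Closed   = FullyClosed C k T

  weak-⊆ : ∀ {Y Y'} → Y ⊆ Y' → IsWeak Y' → IsWeak Y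
  weak-⊆ Y⊆Y' (A , A∈T , Y'⊆A) = A , A∈T , ⊆-trans Y⊆Y' Y'⊆A

  strong-⊇ : ∀ {Y Y'} → Y ⊆ Y' → IsStrong Y → IsStrong Y'
  strong-⊇ Y⊆Y' sY wY' = sY (weak-⊆ Y⊆Y' wY')

  sep-≐ : ∀ {A B} → A ⊆ B → B ⊆ A → Sep A → Sep B
  sep-≐ A⊆B B⊆A = subst Sep (⊆-antisym A⊆B B⊆A)

  high-or-in-tangle : ∀ A → k ≤ conn C A ⊎ (T A ⊎ T (∁ A))
  high-or-in-tangle A with k ℤP.≤? conn C A
  ... | yes k≤λA = inj₁ k≤λA
  ... | no  k≰λA = inj₂ (T2 A (<⇒≤-1 (ℤP.≰⇒> k≰λA)))

  separating-high : ∀ {A Q R} → IsStrong Q → Q ⊆ A → IsStrong R → R ⊆ ∁ A →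
                    k ≤ conn C A
  separating-high {A} sQ Q⊆A sR R⊆∁A with high-or-in-tangle A
  ... | inj₁ k≤λA        = k≤λA
  ... | inj₂ (inj₁ A∈T)  = ⊥-elim (sQ (A , A∈T , Q⊆A))
  ... | inj₂ (inj₂ ∁A∈T) = ⊥-elim (sR (∁ A , ∁A∈T , R⊆∁A))

  ∪-sep : ∀ {A B} → Sep A → Sep B → k ≤ conn C (A ∩ B) → Sep (A ∪ B)
  ∪-sep {A} {B} = uncross-≤ (submod C A B)

  ∩-sep : ∀ {A B} → Sep A → Sep B → k ≤ conn C (A ∪ B) → Sep (A ∩ B)
  ∩-sep {A} {B} = uncross-≤ (subst (_≤ _) (ℤP.+-comm (conn C (A ∪ B)) _) (submod C A B))

  -- The ground set is k-separating (any member of 𝒯 bounds λ(E) below k).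
  whole-sep : ∀ {A} → T A → Sep ⊤
  whole-sep {A} A∈T = ℤP.≤-trans (conn-⊤-least C A) (ℤP.<⇒≤ (T1 A A∈T))

  infix 4 _⊆fcl_
  _⊆fcl_ : Subset m → Subset m → Set
  Y ⊆fcl Q = ∀ e → e ∈ Y → InFcl C k T Q e

  ⊆⇒⊆fcl : ∀ {Y Q} → Y ⊆ Q → Y ⊆fcl Q
  ⊆⇒⊆fcl Y⊆Q e e∈Y Z _ Q⊆Z = Q⊆Z (Y⊆Q e∈Y)

  ⊆fcl-trans : ∀ {Y Q R} → Y ⊆fcl Q → Q ⊆fcl R → Y ⊆fcl R
  ⊆fcl-trans Y⊆Q Q⊆R e e∈Y Z fcZ R⊆Z = Y⊆Q e e∈Y Z fcZ (λ {x} x∈Q → Q⊆R x x∈Q Z fcZ R⊆Z)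

  ⊆fcl-∪ : ∀ {A B Q} → A ⊆fcl Q → B ⊆fcl Q → A ∪ B ⊆fcl Q
  ⊆fcl-∪ {A} {B} A⊆Q B⊆Q e e∈A∪B = [ A⊆Q e , B⊆Q e ] (x∈p∪q⁻ A B e∈A∪B)

  ⊆fcl-⊆ : ∀ {Y Y' Q} → Y' ⊆ Y → Y ⊆fcl Q → Y' ⊆fcl Q
  ⊆fcl-⊆ Y'⊆Y Y⊆Q e e∈Y' = Y⊆Q e (Y'⊆Y e∈Y')

  -- A fully closed Z contains every weak Y with Z ∪ Y k-separating
  -- (Z ∪ Y is given as S, to avoid rewriting set equalities).
  closed-absorbs : ∀ {Z Y S} → Closed Z → IsWeak Y → Sep S →
                   Z ⊆ S → Y ⊆ S → S ⊆ Z ∪ Y → Y ⊆ Z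
  closed-absorbs {Z} {Y} {S} (_ , _ , closed) wY sS Z⊆S Y⊆S S⊆Z∪Y {x} x∈Y with x ∈? Z
  ... | yes x∈Z = x∈Z
  ... | no  x∉Z = ⊥-elim (closed (Y ∩ ∁ Z) (p∩q⊆q Y (∁ Z))
                    (x , x∈p∩q⁺ (x∈Y , x∉p⇒x∈∁p x∉Z))
                    (weak-⊆ (p∩q⊆p Y (∁ Z)) wY)
                    (sep-≐ (⊆-trans S⊆Z∪Y (∪⊆∪-outside Z Y))
                           (∪-least Z⊆S (⊆-trans (p∩q⊆p Y (∁ Z)) Y⊆S)) sS))

  closed-total : ∀ {Z} → Closed Z → IsWeak (∁ Z) → ⊤ ⊆ Z
  closed-total {Z} fcZ w@(A , A∈T , _) {x} _ =
    x∉∁p⇒x∈p (λ x∈∁Z → x∈∁p⇒x∉p x∈∁Z (∁Z⊆Z x∈∁Z))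
    where
      ∁Z⊆Z : ∁ Z ⊆ Z
      ∁Z⊆Z = closed-absorbs fcZ w (whole-sep A∈T) ⊆⊤ ⊆⊤ (⊆-reflexive (sym (p∪∁p≡⊤ Z)))

  -- For fully closed Z ⊇ Q, uncross Z with S: either Z ∪ S is
  -- k-separating and absorbs Y, or Z ∩ S is small and 𝒯 forces Z = E.
  weak-absorbed : ∀ {Q Y S} → IsStrong Q → IsWeak Y → Sep S →
                  Q ⊆ S → Y ⊆ S → S ⊆ Q ∪ Y → Y ⊆fcl Q
  weak-absorbed {Q} {Y} {S} sQ wY sS Q⊆S Y⊆S S⊆Q∪Y e e∈Y Z fcZ Q⊆Z
    with high-or-in-tangle (Z ∩ S)
  ... | inj₁ high = closed-absorbs fcZ wY (∪-sep (proj₁ (proj₂ fcZ)) sS high)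
                      (p⊆p∪q S) (⊆-trans Y⊆S (q⊆p∪q Z S)) Z∪S⊆Z∪Y e∈Y
    where
      Z∪S⊆Z∪Y : Z ∪ S ⊆ Z ∪ Y
      Z∪S⊆Z∪Y = ∪-least (p⊆p∪q Y)
        (⊆-trans S⊆Q∪Y (∪-least (⊆-trans Q⊆Z (p⊆p∪q Y)) (q⊆p∪q Z Y)))
  ... | inj₂ (inj₁ Z∩S∈T)    = ⊥-elim (sQ (Z ∩ S , Z∩S∈T , ∩-greatest Q⊆Z Q⊆S))
  ... | inj₂ (inj₂ ∁[Z∩S]∈T) =
          closed-total fcZ (∁ (Z ∩ S) , ∁[Z∩S]∈T , p⊆q⇒∁p⊇∁q (p∩q⊆p Z S)) ∈⊤

  -- Two-step absorption: with A strong and A ∪ B k-separating, a weak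
  -- B − X joins fcl(A) together with B ∩ X, via Q = A ∪ (B ∩ X).
  split-absorbed : ∀ {A B X} → IsStrong A → Sep (A ∪ B) → IsWeak (B ∩ ∁ X) →
                   B ∩ X ⊆fcl A → B ⊆fcl A
  split-absorbed {A} {B} {X} sA sA∪B wB-X B∩X⊆A =
    ⊆fcl-⊆ (∩-split B X) (⊆fcl-∪ B∩X⊆A (⊆fcl-trans B-X⊆Q Q⊆A))
    where
      Q : Subset m
      Q = A ∪ (B ∩ X)
      Q⊆A : Q ⊆fcl A
      Q⊆A = ⊆fcl-∪ (⊆⇒⊆fcl ⊆-refl) B∩X⊆A
      B-X⊆Q : B ∩ ∁ X ⊆fcl Q
      B-X⊆Q = weak-absorbed (strong-⊇ (p⊆p∪q _) sA) wB-X sA∪B Q⊆A∪B B-X⊆A∪B A∪B⊆Q∪[B-X]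
        where
          Q⊆A∪B : Q ⊆ A ∪ B
          Q⊆A∪B = ∪-least (p⊆p∪q B) (⊆-trans (p∩q⊆p B X) (q⊆p∪q A B))
          B-X⊆A∪B : B ∩ ∁ X ⊆ A ∪ B
          B-X⊆A∪B = ⊆-trans (p∩q⊆p B (∁ X)) (q⊆p∪q A B)
          A∪B⊆Q∪[B-X] : A ∪ B ⊆ Q ∪ (B ∩ ∁ X)
          A∪B⊆Q∪[B-X] = ∪-least (⊆-trans (p⊆p∪q _) (p⊆p∪q _))
            (⊆-trans (∩-split B X) (∪-least (⊆-trans (q⊆p∪q A _) (p⊆p∪q _)) (q⊆p∪q Q _)))

module FlowerArgument {m : ℕ} (C : ConnSystem m) (k : ℤ) (T : Subset m → Set)
    (tangle : IsTangle C k T) (S : Subset m → Set)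
    {n : ℕ} (P : Fin (sucℕ n) → Subset m) (isF : IsFlower C k T S P)
    (noLoose : NoLoosePetals C k T S (mkFlower C k T S P isF))
    (X : Subset m) (X-weak : Weak C k T X) (P₀∪X-sep : KSep C k (P zero ∪ X)) where

  open TangleFacts C k T tangle
  open Segments P
  open IsFlower isF using (adjSep) renaming (strongPetals to petal-strong)

  last : Fin (sucℕ n)
  last = fromℕ n

  petals-apart : ∀ {s t x} → toℕ s ≢ toℕ t → x ∈ P s → x ∉ P t
  petals-apart {s} {t} {x} s≢t x∈Pₛ x∈Pₜ = ∉⊥ (subst (x ∈_)
    (IsFlower.disjoint isF s t (λ s≡t → s≢t (cong toℕ s≡t))) (x∈p∩q⁺ (x∈Pₛ , x∈Pₜ)))

  last-apart : ∀ {s x} → toℕ s ℕ.< n → x ∈ P last → x ∉ P s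
  last-apart s<n = petals-apart (λ e → ℕP.<⇒≢ s<n (trans (sym e) (FinP.toℕ-fromℕ n)))

  segment-apart : ∀ {h t x} → h ℕ.< toℕ t → x ∈ P t → x ∉ segment h
  segment-apart h<t x∈Pₜ x∈seg with segment⁻ x∈seg
  ... | s , s≤h , x∈Pₛ = petals-apart (ℕP.<⇒≢ (ℕP.≤-<-trans s≤h h<t)) x∈Pₛ x∈Pₜ

  not-in-fcl-of-neighbour : ∀ i j → j ≢ i → CycSucc i j ⊎ CycSucc j i → ¬ (P i ⊆fcl P j)
  not-in-fcl-of-neighbour i j j≢i adjacent Pᵢ⊆fclPⱼ =
    noLoose i (j , j≢i , Sum.map₂ inj₁ adjacent , Pᵢ⊆fclPⱼ)

  X⊆fclP₀ : X ⊆fcl P zero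
  X⊆fclP₀ = weak-absorbed (petal-strong zero) X-weak P₀∪X-sep (p⊆p∪q X) (q⊆p∪q _ X) ⊆-refl

  -- The last petal is a neighbour of P₀, so if Pₙ − X were weak, then
  -- split-absorption with X ⊆ fcl(P₀) would make Pₙ loose.
  last-minus-X-strong : 0 ℕ.< n → IsStrong (P last ∩ ∁ X)
  last-minus-X-strong n>0 Pₙ-X-weak = not-in-fcl-of-neighbour last zero zero≢last
    (inj₁ last→first)
    (split-absorbed (petal-strong zero) P₀∪Pₙ-sep Pₙ-X-weak (⊆fcl-⊆ (p∩q⊆q _ X) X⊆fclP₀))
    where
      last→first : CycSucc last zero
      last→first = inj₂ (cong sucℕ (FinP.toℕ-fromℕ n) , refl)
      zero≢last : zero ≢ last
      zero≢last e = ℕP.<⇒≢ n>0 (trans (cong toℕ e) (FinP.toℕ-fromℕ n))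
      P₀∪Pₙ-sep : Sep (P zero ∪ P last)
      P₀∪Pₙ-sep = subst Sep (∪-comm (P last) (P zero)) (adjSep last zero last→first)

  module Pair (h : ℕ) (j : Fin n) (j≡h : toℕ j ≡ h) (h+1<n : sucℕ h ℕ.< n) where
    a b : Fin (sucℕ n)
    a = inject₁ j
    b = suc j

    a≡h : toℕ a ≡ h
    a≡h = trans (FinP.toℕ-inject₁ j) j≡h

    b≡h+1 : toℕ b ≡ sucℕ h
    b≡h+1 = cong sucℕ j≡h

    h<n : h ℕ.< n
    h<n = ℕP.<-trans (ℕP.n<1+n h) h+1<n

    a→b : CycSucc a b
    a→b = inj₁ (cong sucℕ (FinP.toℕ-inject₁ j))

    a≢b : a ≢ b
    a≢b a≡b = ℕP.<⇒≢ (ℕP.n<1+n (toℕ j)) (trans (sym (FinP.toℕ-inject₁ j)) (cong toℕ a≡b))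

    D V : Subset m
    D = segment h ∪ X
    V = P a ∪ P b

    V-sep : Sep V
    V-sep = adjSep a b a→b

    Pₐ⊆D∩V : P a ⊆ D ∩ V
    Pₐ⊆D∩V = ∩-greatest (⊆-trans (segment⁺ (ℕP.≤-reflexive a≡h)) (p⊆p∪q X)) (p⊆p∪q _)

    last∉V : ∀ {x} → x ∈ P last → x ∉ V
    last∉V x∈Pₙ x∈V = [ last-apart (subst (ℕ._< n) (sym a≡h) h<n) x∈Pₙ
                       , last-apart (subst (ℕ._< n) (sym b≡h+1) h+1<n) x∈Pₙ ]
                       (x∈p∪q⁻ (P a) (P b) x∈V)

    D-apart : ∀ {t x} → h ℕ.< toℕ t → x ∈ P t → x ∈ D → x ∈ X
    D-apart h<t x∈Pₜ x∈D =
      [ (λ x∈seg → ⊥-elim (segment-apart h<t x∈Pₜ x∈seg)) , (λ x∈X → x∈X) ] (x∈p∪q⁻ _ X x∈D)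

    -- Uncrossing D with V: D ∩ V ⊇ Pₐ and Pₙ avoids it, so D ∪ V, which is
    -- the next segment set, is k-separating.
    segment-step : Sep D → Sep (segment (sucℕ h) ∪ X)
    segment-step D-sep = sep-≐ D∪V⊆next next⊆D∪V (∪-sep D-sep V-sep D∩V-high)
      where
        D∩V-high : k ≤ conn C (D ∩ V)
        D∩V-high = separating-high (petal-strong a) Pₐ⊆D∩V (petal-strong last)
          (λ x∈Pₙ → x∉p⇒x∈∁p (λ x∈D∩V → last∉V x∈Pₙ (proj₂ (x∈p∩q⁻ D V x∈D∩V))))
        D∪V⊆next : D ∪ V ⊆ segment (sucℕ h) ∪ X
        D∪V⊆next = ∪-least
          (∪-least (⊆-trans (segment-mono (ℕP.n≤1+n h)) (p⊆p∪q X)) (q⊆p∪q _ X))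
          (∪-least (⊆-trans (segment⁺ (ℕP.≤-trans (ℕP.≤-reflexive a≡h) (ℕP.n≤1+n h))) (p⊆p∪q X))
                   (⊆-trans (segment⁺ (ℕP.≤-reflexive b≡h+1)) (p⊆p∪q X)))
        next⊆D∪V : segment (sucℕ h) ∪ X ⊆ D ∪ V
        next⊆D∪V = ∪-least
          (⊆-trans (segment-suc b≡h+1)
            (∪-least (⊆-trans (p⊆p∪q X) (p⊆p∪q V)) (⊆-trans (q⊆p∪q (P a) (P b)) (q⊆p∪q D V))))
          (⊆-trans (q⊆p∪q _ X) (p⊆p∪q V))

  segment-sep : ∀ h → h ℕ.< n → Sep (segment h ∪ X)
  segment-sep ℕ.zero _ = sep-≐ (∪-least (⊆-trans (segment⁺ {0} ℕ.z≤n) (p⊆p∪q X)) (q⊆p∪q _ X))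
                               (∪-least (⊆-trans segment⁰⊆P₀ (p⊆p∪q X)) (q⊆p∪q _ X)) P₀∪X-sep
    where
      segment⁰⊆P₀ : segment 0 ⊆ P zero
      segment⁰⊆P₀ {x} x∈seg with segment⁻ x∈seg
      ... | s , s≤0 , x∈Pₛ = subst (λ t → x ∈ P t) (FinP.toℕ-injective (ℕP.n≤0⇒n≡0 s≤0)) x∈Pₛ
  segment-sep (sucℕ h) h+1<n = segment-step (segment-sep h h<n)
    where
      h<n : h ℕ.< n
      h<n = ℕP.<-trans (ℕP.n<1+n h) h+1<n
      open Pair h (fromℕ< h<n) (FinP.toℕ-fromℕ< h<n) h+1<n hiding (h<n)

  -- Inner petals: for a = j, b = j + 1 with j + 1 < n, the set D ∪ V contains
  -- P₀ and avoids the strong set Pₙ − X, so λ(D ∪ V) ≥ k and D ∩ V =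
  -- Pₐ ∪ (Pᵦ ∩ X) is k-separating.  Hence Pᵦ ∩ X ⊆ fcl(Pₐ), and a weak
  -- Pᵦ − X would make Pᵦ loose.
  inner-minus-X-strong : (j : Fin n) → sucℕ (toℕ j) ℕ.< n → IsStrong (P (suc j) ∩ ∁ X)
  inner-minus-X-strong j j+1<n Pᵦ-X-weak = not-in-fcl-of-neighbour b a a≢b (inj₂ a→b)
    (split-absorbed (petal-strong a) V-sep Pᵦ-X-weak Pᵦ∩X⊆fclPₐ)
    where
      open Pair (toℕ j) j refl j+1<n

      P₀⊆D∪V : P zero ⊆ D ∪ V
      P₀⊆D∪V = ⊆-trans (segment⁺ {toℕ j} ℕ.z≤n) (⊆-trans (p⊆p∪q X) (p⊆p∪q V))

      Pₙ-X⊆∁[D∪V] : P last ∩ ∁ X ⊆ ∁ (D ∪ V)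
      Pₙ-X⊆∁[D∪V] x∈ = x∉p⇒x∈∁p λ x∈D∪V → [
          (λ x∈D → x∈∁p⇒x∉p x∉X (D-apart h<last x∈Pₙ x∈D)) , last∉V x∈Pₙ ]
          (x∈p∪q⁻ D V x∈D∪V)
        where
          x∈Pₙ : _ ∈ P last
          x∈Pₙ = proj₁ (x∈p∩q⁻ (P last) (∁ X) x∈)
          x∉X : _ ∈ ∁ X
          x∉X = proj₂ (x∈p∩q⁻ (P last) (∁ X) x∈)
          h<last : toℕ j ℕ.< toℕ last
          h<last = subst (toℕ j ℕ.<_) (sym (FinP.toℕ-fromℕ n)) h<n

      D∪V-high : k ≤ conn C (D ∪ V)
      D∪V-high = separating-high (petal-strong zero) P₀⊆D∪V
        (last-minus-X-strong (ℕP.≤-<-trans ℕ.z≤n h<n)) Pₙ-X⊆∁[D∪V]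

      Pᵦ∩X⊆D∩V : P b ∩ X ⊆ D ∩ V
      Pᵦ∩X⊆D∩V = ∩-greatest (⊆-trans (p∩q⊆q _ X) (q⊆p∪q _ X))
                            (⊆-trans (p∩q⊆p _ X) (q⊆p∪q (P a) _))

      D∩V⊆Pₐ∪[Pᵦ∩X] : D ∩ V ⊆ P a ∪ (P b ∩ X)
      D∩V⊆Pₐ∪[Pᵦ∩X] x∈D∩V with x∈p∩q⁻ D V x∈D∩V
      ... | x∈D , x∈V = [ p⊆p∪q _ ,
            (λ x∈Pᵦ → q⊆p∪q (P a) _ (x∈p∩q⁺ (x∈Pᵦ , D-apart (ℕP.n<1+n _) x∈Pᵦ x∈D))) ]
            (x∈p∪q⁻ (P a) (P b) x∈V)

      Pᵦ∩X⊆fclPₐ : P b ∩ X ⊆fcl P a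
      Pᵦ∩X⊆fclPₐ = weak-absorbed (petal-strong a) (weak-⊆ (p∩q⊆q _ X) X-weak)
        (∩-sep (segment-sep (toℕ j) h<n) V-sep D∪V-high) Pₐ⊆D∩V Pᵦ∩X⊆D∩V D∩V⊆Pₐ∪[Pᵦ∩X]

lemma4p5 : (m : ℕ) (C : ConnSystem m) (k : ℤ) (T : Subset m → Set) →
    IsTangle C k T →
    (S : Subset m → Set) → ValidS C k T S → TreeCompatible C k T S →
    (n : ℕ) (P : Fin (sucℕ n) → Subset m) (isF : IsFlower C k T S P) →
    SOrderAtLeast2 C k T S (mkFlower C k T S P isF) →
    NoLoosePetals C k T S (mkFlower C k T S P isF) →
    (X : Subset m) → X ⊆ ∁ (P zero) → Nonempty X → Weak C k T X →
    KSep C k (P zero ∪ X) →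
    (j : Fin n) → Strong C k T (P (suc j) ∩ ∁ X)
lemma4p5 m C k T tangle S _ _ n P isF _ noLoose X _ _ X-weak P₀∪X-sep j =
  [ inner-minus-X-strong j , last-case ]′ (ℕP.m≤n⇒m<n∨m≡n (FinP.toℕ<n j))
  where
    open FlowerArgument C k T tangle S P isF noLoose X X-weak P₀∪X-sep

    last-case : sucℕ (toℕ j) ≡ n → Strong C k T (P (suc j) ∩ ∁ X)
    last-case j+1≡n = subst (λ i → Strong C k T (P i ∩ ∁ X))
      (FinP.toℕ-injective (trans (FinP.toℕ-fromℕ n) (sym j+1≡n)))
      (last-minus-X-strong (ℕP.≤-<-trans ℕ.z≤n (FinP.toℕ<n j)))
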